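{- Let $\delta\ge 2$ and $t\ge \delta+1$, and let $G$ be a simple graph on $n$ vertices with minimum degree exactly $\delta$. If $i_t(G)\le i_t(K_{\delta,n-\delta})$, then $i_{t+1}(G)\le i_{t+1}(K_{\delta,n-\delta})$. Moreover, if $t<n-\delta$ and $i_t(G)< i_t(K_{\delta,n-\delta})$, then $i_{t+1}(G)< i_{t+1}(K_{\delta,n-\delta})$.
   Context: $i_t(G)$ denotes the number of independent sets of size $t$ in $G$ (sets of $t$ vertices spanning no edges). $K_{a,b}$ is the complete bipartite graph with partite sets of sizes $a$ and $b$; $i_t(K_{\delta,n-\delta})=\binom{n-\delta}{t}+\binom{\delta}{t}$. -}

module Defs where

open import Data.Nat using (ℕ; zero; suc; _≤_; _<_; _+_)
open import Data.Bool using (Bool; true; false; _∧_; not; if_then_else_)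
open import Data.Fin using (Fin)
open import Data.Fin.Subset using (Subset; ∣_∣; _∈_)
open import Data.Vec using (Vec; []; _∷_; lookup)
open import Data.List using (List; []; _∷_; map; _++_; length; filter; allFin)
open import Data.Bool.ListAction using (and)
open import Data.Product using (Σ; _×_; ∃)
open import Relation.Binary.PropositionalEquality using (_≡_)
open import Relation.Nullary.Decidable using (does)
open import Data.Nat using (_≟_)

record Graph (n : ℕ) : Set where
  field
    adj     : Fin n → Fin n → Bool
    sym     : ∀ u v → adj u v ≡ adj v u
    irrefl  : ∀ v → adj v v ≡ false
open Graph public

countTrue : List Bool → ℕ
countTrue []            = 0
countTrue (true  ∷ bs)  = suc (countTrue bs)
countTrue (false ∷ bs)  = countTrue bs

degree : ∀ {n} → Graph n → Fin n → ℕ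
degree G v = countTrue (map (adj G v) (allFin _))

MinDegree : ∀ {n} → Graph n → ℕ → Set
MinDegree G δ = (∀ v → δ ≤ degree G v) × ∃ λ v → degree G v ≡ δ

allSubsets : (n : ℕ) → List (Subset n)
allSubsets zero    = [] ∷ []
allSubsets (suc n) = map (false ∷_) (allSubsets n) ++ map (true ∷_) (allSubsets n)

isIndependent : ∀ {n} → Graph n → Subset n → Bool
isIndependent {n} G S =
  and (map (λ u → and (map (λ v →
         not (lookup S u ∧ lookup S v ∧ adj G u v)) (allFin n))) (allFin n))

hasSize : ∀ {n} → ℕ → Subset n → Bool
hasSize t S = does (∣ S ∣ ≟ t)

indepCount : ∀ {n} → ℕ → Graph n → ℕ
indepCount {n} t G =
  countTrue (map (λ S → isIndependent G S ∧ hasSize t S) (allSubsets n))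

{-# OPTIONS --safe #-}
-- Double counting pairs (independent (t+1)-set, one of its vertices): deleting the vertex
-- leaves an independent t-set S, and since t ≥ 1 a vertex can only be added to S if it lies
-- outside S and outside the neighbourhood of a fixed u ∈ S, which leaves at most
-- n − t − deg u ≤ n − t − δ candidates. So (t+1) i_{t+1}(G) ≤ (n − δ − t) i_t(G), whereas
-- t > δ makes i_t(K_{δ,n−δ}) = C(n−δ, t), for which (t+1) C(m, t+1) = (m − t) C(m, t) is
-- the same relation with equality.
module Submission where

open import Defs hiding (sym)
open import Data.Nat using (ℕ; zero; suc; _≤_; _<_; _+_; _*_; _∸_; z≤n; s≤s; >-nonZero)
open import Data.Nat.Properties
open import Data.Nat.Combinatorics using (_C_; nC1≡n; k>n⇒nCk≡0; nCk+nC[k+1]≡[n+1]C[k+1])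
open import Data.Nat.Solver using (module +-*-Solver)
open import Data.Bool using (Bool; true; false; _∧_; not; T)
open import Data.Bool.Properties using (∧-zeroʳ; ∧-identityʳ; T-≡; T-not-≡)
open import Data.Fin using (Fin; zero; suc)
open import Data.Fin.Subset using (Subset; ∣_∣)
open import Data.Bool.ListAction using (all)
open import Data.Vec using ([]; _∷_; lookup; _[_]≔_)
open import Data.Vec.Properties using (lookup∘update)
open import Data.List using ([]; _∷_; map; _++_; tabulate; allFin)
open import Data.List.Properties using (map-++; map-∘; map-tabulate)
open import Data.List.Relation.Unary.All.Properties using (all⁺; all⁻; tabulate⁺; tabulate⁻)
open import Data.Product using (_×_; _,_; ∃; proj₁; proj₂)
open import Function using (_∘_; id; Equivalence)
open import Relation.Binary.PropositionalEquality
open import Algebra.Properties.CommutativeMonoid.Sum +-0-commutativeMonoid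
  using (sum; sum-syntax; sum-cong-≗; sum-replicate-zero; ∑-distrib-+)
open import Algebra.Properties.CommutativeSemigroup +-commutativeSemigroup using (interchange)

𝟙 : Bool → ℕ
𝟙 true  = 1
𝟙 false = 0

𝟙-mono : ∀ {b c} → (b ≡ true → c ≡ true) → 𝟙 b ≤ 𝟙 c
𝟙-mono {false}         _   = z≤n
𝟙-mono {true}  {true}  _   = ≤-refl
𝟙-mono {true}  {false} b⇒c with b⇒c refl
... | ()

∑-mono-≤ : ∀ {n} {f g : Fin n → ℕ} → (∀ i → f i ≤ g i) → sum f ≤ sum g
∑-mono-≤ {zero}  f≤g = z≤n
∑-mono-≤ {suc n} f≤g = +-mono-≤ (f≤g zero) (∑-mono-≤ (f≤g ∘ suc))

∑-const-1 : ∀ n → ∑[ i < n ] 1 ≡ n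
∑-const-1 zero    = refl
∑-const-1 (suc n) = cong suc (∑-const-1 n)

∑ₛ : ∀ {n} → (Subset n → ℕ) → ℕ
∑ₛ {zero}  f = f []
∑ₛ {suc n} f = ∑ₛ (f ∘ (false ∷_)) + ∑ₛ (f ∘ (true ∷_))

∑ₛ-cong : ∀ {n} {f g : Subset n → ℕ} → (∀ S → f S ≡ g S) → ∑ₛ f ≡ ∑ₛ g
∑ₛ-cong {zero}  f≗g = f≗g []
∑ₛ-cong {suc n} f≗g = cong₂ _+_ (∑ₛ-cong (f≗g ∘ (false ∷_))) (∑ₛ-cong (f≗g ∘ (true ∷_)))

∑ₛ-mono-≤ : ∀ {n} {f g : Subset n → ℕ} → (∀ S → f S ≤ g S) → ∑ₛ f ≤ ∑ₛ g
∑ₛ-mono-≤ {zero}  f≤g = f≤g []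
∑ₛ-mono-≤ {suc n} f≤g = +-mono-≤ (∑ₛ-mono-≤ (f≤g ∘ (false ∷_))) (∑ₛ-mono-≤ (f≤g ∘ (true ∷_)))

∑ₛ-zero : ∀ n → ∑ₛ {n} (λ _ → 0) ≡ 0
∑ₛ-zero zero    = refl
∑ₛ-zero (suc n) = cong₂ _+_ (∑ₛ-zero n) (∑ₛ-zero n)

∑ₛ-distrib-+ : ∀ {n} (f g : Subset n → ℕ) → ∑ₛ (λ S → f S + g S) ≡ ∑ₛ f + ∑ₛ g
∑ₛ-distrib-+ {zero}  f g = refl
∑ₛ-distrib-+ {suc n} f g = begin
  ∑ₛ (λ S → f₀ S + g₀ S) + ∑ₛ (λ S → f₁ S + g₁ S)
    ≡⟨ cong₂ _+_ (∑ₛ-distrib-+ f₀ g₀) (∑ₛ-distrib-+ f₁ g₁) ⟩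
  (∑ₛ f₀ + ∑ₛ g₀) + (∑ₛ f₁ + ∑ₛ g₁)
    ≡⟨ interchange (∑ₛ f₀) (∑ₛ g₀) (∑ₛ f₁) (∑ₛ g₁) ⟩
  (∑ₛ f₀ + ∑ₛ f₁) + (∑ₛ g₀ + ∑ₛ g₁) ∎
  where
  open ≡-Reasoning
  f₀ = f ∘ (false ∷_); f₁ = f ∘ (true ∷_)
  g₀ = g ∘ (false ∷_); g₁ = g ∘ (true ∷_)

∑ₛ-distribʳ-* : ∀ {n} (f : Subset n → ℕ) c → ∑ₛ (λ S → f S * c) ≡ ∑ₛ f * c
∑ₛ-distribʳ-* {zero}  f c = refl
∑ₛ-distribʳ-* {suc n} f c = trans
  (cong₂ _+_ (∑ₛ-distribʳ-* (f ∘ (false ∷_)) c) (∑ₛ-distribʳ-* (f ∘ (true ∷_)) c))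
  (sym (*-distribʳ-+ c (∑ₛ (f ∘ (false ∷_))) _))

∑ₛ-∑-comm : ∀ {n m} (f : Subset n → Fin m → ℕ) →
            ∑ₛ (λ S → ∑[ i < m ] f S i) ≡ ∑[ i < m ] ∑ₛ (λ S → f S i)
∑ₛ-∑-comm {n} {zero}  f = ∑ₛ-zero n
∑ₛ-∑-comm {n} {suc m} f = trans
  (∑ₛ-distrib-+ (λ S → f S zero) (λ S → ∑[ i < m ] f S (suc i)))
  (cong (∑ₛ (λ S → f S zero) +_) (∑ₛ-∑-comm (λ S → f S ∘ suc)))

-- S ↦ S ∪ {v} is a bijection from the sets avoiding v onto the sets containing v.
∑ₛ-containing≡∑ₛ-avoiding : ∀ {n} (v : Fin n) (P : Subset n → Bool) →
  ∑ₛ (λ S → 𝟙 (lookup S v ∧ P S)) ≡ ∑ₛ (λ S → 𝟙 (not (lookup S v) ∧ P (S [ v ]≔ true)))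
∑ₛ-containing≡∑ₛ-avoiding {suc n} zero    P rewrite ∑ₛ-zero n = sym (+-identityʳ _)
∑ₛ-containing≡∑ₛ-avoiding {suc n} (suc v) P = cong₂ _+_
  (∑ₛ-containing≡∑ₛ-avoiding v (P ∘ (false ∷_)))
  (∑ₛ-containing≡∑ₛ-avoiding v (P ∘ (true ∷_)))

∣∣≡∑ : ∀ {n} (S : Subset n) → ∣ S ∣ ≡ ∑[ i < n ] 𝟙 (lookup S i)
∣∣≡∑ []          = refl
∣∣≡∑ (true ∷ S)  = cong suc (∣∣≡∑ S)
∣∣≡∑ (false ∷ S) = ∣∣≡∑ S

∣[]≔true∣ : ∀ {n} (S : Subset n) v → lookup S v ≡ false → ∣ S [ v ]≔ true ∣ ≡ suc ∣ S ∣
∣[]≔true∣ (false ∷ S) zero    _    = refl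
∣[]≔true∣ (true ∷ S)  (suc v) v∉S = cong suc (∣[]≔true∣ S v v∉S)
∣[]≔true∣ (false ∷ S) (suc v) v∉S = ∣[]≔true∣ S v v∉S

lookup-[]≔true : ∀ {n} (S : Subset n) v {u} → lookup S u ≡ true → lookup (S [ v ]≔ true) u ≡ true
lookup-[]≔true (_ ∷ S) zero    {zero}  _   = refl
lookup-[]≔true (_ ∷ S) zero    {suc u} u∈S = u∈S
lookup-[]≔true (_ ∷ S) (suc v) {zero}  u∈S = u∈S
lookup-[]≔true (_ ∷ S) (suc v) {suc u} u∈S = lookup-[]≔true S v u∈S

∑-∈-∧ : ∀ {n} (S : Subset n) b → ∑[ i < n ] 𝟙 (lookup S i ∧ b) ≡ 𝟙 b * ∣ S ∣
∑-∈-∧ {n} S true  = trans (sum-cong-≗ (cong 𝟙 ∘ ∧-identityʳ ∘ lookup S))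
                          (trans (sym (∣∣≡∑ S)) (sym (+-identityʳ ∣ S ∣)))
∑-∈-∧ {n} S false = trans (sum-cong-≗ (cong 𝟙 ∘ ∧-zeroʳ ∘ lookup S)) (sum-replicate-zero n)

∃-member : ∀ {n} (S : Subset n) → 1 ≤ ∣ S ∣ → ∃ λ u → lookup S u ≡ true
∃-member (true ∷ S)  _ = zero , refl
∃-member (false ∷ S) h with ∃-member S h
... | u , u∈S = suc u , u∈S

hasSize⇒≡ : ∀ {n} k (S : Subset n) → hasSize k S ≡ true → ∣ S ∣ ≡ k
hasSize⇒≡ k S eq = ≡ᵇ⇒≡ ∣ S ∣ k (Equivalence.from T-≡ eq)

≡⇒hasSize : ∀ {n} k (S : Subset n) → ∣ S ∣ ≡ k → hasSize k S ≡ true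
≡⇒hasSize k S eq = Equivalence.to T-≡ (≡⇒≡ᵇ ∣ S ∣ k eq)

𝟙-∧-hasSize-* : ∀ {n} k (P : Subset n → Bool) S →
                𝟙 (P S ∧ hasSize k S) * ∣ S ∣ ≡ 𝟙 (P S ∧ hasSize k S) * k
𝟙-∧-hasSize-* k P S with P S | hasSize k S in size
... | false | _     = refl
... | true  | false = refl
... | true  | true  = cong (1 *_) (hasSize⇒≡ k S size)

-- Both sides count the pairs (S ∪ {v}, v) with v ∉ S and P (S ∪ {v}).
∑ₛ-size≡∑ₛ-extensions : ∀ {n} (P : Subset n → Bool) →
  ∑ₛ (λ S → 𝟙 (P S) * ∣ S ∣) ≡ ∑ₛ (λ S → ∑[ v < n ] 𝟙 (not (lookup S v) ∧ P (S [ v ]≔ true)))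
∑ₛ-size≡∑ₛ-extensions {n} P = begin
  ∑ₛ (λ S → 𝟙 (P S) * ∣ S ∣)
    ≡⟨ ∑ₛ-cong (λ S → sym (∑-∈-∧ S (P S))) ⟩
  ∑ₛ (λ S → ∑[ v < n ] 𝟙 (lookup S v ∧ P S))
    ≡⟨ ∑ₛ-∑-comm (λ S v → 𝟙 (lookup S v ∧ P S)) ⟩
  ∑[ v < n ] ∑ₛ (λ S → 𝟙 (lookup S v ∧ P S))
    ≡⟨ sum-cong-≗ (λ v → ∑ₛ-containing≡∑ₛ-avoiding v P) ⟩
  ∑[ v < n ] ∑ₛ (λ S → 𝟙 (not (lookup S v) ∧ P (S [ v ]≔ true)))
    ≡⟨ ∑ₛ-∑-comm (λ S v → 𝟙 (not (lookup S v) ∧ P (S [ v ]≔ true))) ⟨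
  ∑ₛ (λ S → ∑[ v < n ] 𝟙 (not (lookup S v) ∧ P (S [ v ]≔ true))) ∎
  where open ≡-Reasoning

∑-𝟙-partition : ∀ {n} (a b : Fin n → Bool) → (∀ i → a i ∧ b i ≡ false) →
  ∑[ i < n ] 𝟙 (a i) + ∑[ i < n ] 𝟙 (b i) + ∑[ i < n ] 𝟙 (not (a i) ∧ not (b i)) ≡ n
∑-𝟙-partition {n} a b disjoint = begin
  ∑[ i < n ] 𝟙 (a i) + ∑[ i < n ] 𝟙 (b i) + ∑[ i < n ] 𝟙 (neither i)
    ≡⟨ cong (_+ ∑[ i < n ] 𝟙 (neither i)) (∑-distrib-+ (𝟙 ∘ a) (𝟙 ∘ b)) ⟨
  ∑[ i < n ] (𝟙 (a i) + 𝟙 (b i)) + ∑[ i < n ] 𝟙 (neither i)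
    ≡⟨ ∑-distrib-+ (λ i → 𝟙 (a i) + 𝟙 (b i)) (𝟙 ∘ neither) ⟨
  ∑[ i < n ] (𝟙 (a i) + 𝟙 (b i) + 𝟙 (neither i))
    ≡⟨ sum-cong-≗ (λ i → exactly-one (a i) (b i) (disjoint i)) ⟩
  ∑[ i < n ] 1
    ≡⟨ ∑-const-1 n ⟩
  n ∎
  where
  open ≡-Reasoning
  neither : Fin n → Bool
  neither i = not (a i) ∧ not (b i)
  exactly-one : ∀ x y → x ∧ y ≡ false → 𝟙 x + 𝟙 y + 𝟙 (not x ∧ not y) ≡ 1
  exactly-one true  false _ = refl
  exactly-one false true  _ = refl
  exactly-one false false _ = refl

countTrue-++ : ∀ bs cs → countTrue (bs ++ cs) ≡ countTrue bs + countTrue cs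
countTrue-++ []           cs = refl
countTrue-++ (true ∷ bs)  cs = cong suc (countTrue-++ bs cs)
countTrue-++ (false ∷ bs) cs = countTrue-++ bs cs

countTrue-allSubsets : ∀ {n} (g : Subset n → Bool) → countTrue (map g (allSubsets n)) ≡ ∑ₛ (𝟙 ∘ g)
countTrue-allSubsets {zero} g with g []
... | true  = refl
... | false = refl
countTrue-allSubsets {suc n} g = begin
  countTrue (map g (map (false ∷_) Sₙ ++ map (true ∷_) Sₙ))
    ≡⟨ cong countTrue (map-++ g (map (false ∷_) Sₙ) _) ⟩
  countTrue (map g (map (false ∷_) Sₙ) ++ map g (map (true ∷_) Sₙ))
    ≡⟨ countTrue-++ (map g (map (false ∷_) Sₙ)) _ ⟩
  countTrue (map g (map (false ∷_) Sₙ)) + countTrue (map g (map (true ∷_) Sₙ))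
    ≡⟨ cong₂ _+_ (cong countTrue (map-∘ Sₙ)) (cong countTrue (map-∘ Sₙ)) ⟨
  countTrue (map (g ∘ (false ∷_)) Sₙ) + countTrue (map (g ∘ (true ∷_)) Sₙ)
    ≡⟨ cong₂ _+_ (countTrue-allSubsets (g ∘ (false ∷_))) (countTrue-allSubsets (g ∘ (true ∷_))) ⟩
  ∑ₛ (𝟙 ∘ g) ∎
  where
  open ≡-Reasoning
  Sₙ = allSubsets n

countTrue-tabulate : ∀ {n} (b : Fin n → Bool) → countTrue (tabulate b) ≡ ∑[ i < n ] 𝟙 (b i)
countTrue-tabulate {zero}  b = refl
countTrue-tabulate {suc n} b with b zero
... | true  = cong suc (countTrue-tabulate (b ∘ suc))
... | false = countTrue-tabulate (b ∘ suc)

degree≡∑ : ∀ {n} (G : Graph n) u → degree G u ≡ ∑[ v < n ] 𝟙 (adj G u v)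
degree≡∑ G u = trans (cong countTrue (map-tabulate id (adj G u))) (countTrue-tabulate (adj G u))

Independent : ∀ {n} → Graph n → Subset n → Set
Independent G S = ∀ {u v} → lookup S u ≡ true → lookup S v ≡ true → adj G u v ≡ false

isIndependent⇒Independent : ∀ {n} (G : Graph n) S → isIndependent G S ≡ true → Independent G S
isIndependent⇒Independent {n} G S indep {u} {v} u∈S v∈S =
  Equivalence.to T-not-≡ (subst₂ (λ x y → T (not (x ∧ y ∧ adj G u v))) u∈S v∈S entry)
  where
  row : T (all (λ w → not (lookup S u ∧ lookup S w ∧ adj G u w)) (allFin n))
  row = tabulate⁻ (all⁺ _ (allFin n) (Equivalence.from T-≡ indep)) u
  entry : T (not (lookup S u ∧ lookup S v ∧ adj G u v))
  entry = tabulate⁻ (all⁺ _ (allFin n) row) v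

Independent⇒isIndependent : ∀ {n} (G : Graph n) S → Independent G S → isIndependent G S ≡ true
Independent⇒isIndependent G S indep =
  Equivalence.to T-≡ (all⁻ _ (tabulate⁺ λ u → all⁻ _ (tabulate⁺ λ v → entry u v)))
  where
  entry : ∀ u v → T (not (lookup S u ∧ lookup S v ∧ adj G u v))
  entry u v with lookup S u in u∈S | lookup S v in v∈S
  ... | false | _     = _
  ... | true  | false = _
  ... | true  | true  = Equivalence.from T-not-≡ (indep u∈S v∈S)

Independent-[]≔true⁻ : ∀ {n} (G : Graph n) S v → Independent G (S [ v ]≔ true) → Independent G S
Independent-[]≔true⁻ G S v indep u∈S w∈S = indep (lookup-[]≔true S v u∈S) (lookup-[]≔true S v w∈S)

module _ {n : ℕ} (G : Graph n) where

  indepOfSize : ℕ → Subset n → Bool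
  indepOfSize k S = isIndependent G S ∧ hasSize k S

  extends : ℕ → Subset n → Fin n → Bool
  extends k S v = not (lookup S v) ∧ indepOfSize (suc k) (S [ v ]≔ true)

  indepOfSize⇒ : ∀ k S → indepOfSize k S ≡ true → Independent G S × ∣ S ∣ ≡ k
  indepOfSize⇒ k S S-indep with isIndependent G S in indep | hasSize k S in size
  indepOfSize⇒ k S () | false | _
  indepOfSize⇒ k S () | true  | false
  ... | true | true = isIndependent⇒Independent G S indep , hasSize⇒≡ k S size

  extends⇒ : ∀ k S v → extends k S v ≡ true →
             lookup S v ≡ false × Independent G (S [ v ]≔ true) × ∣ S [ v ]≔ true ∣ ≡ suc k
  extends⇒ k S v ext with lookup S v | indepOfSize (suc k) (S [ v ]≔ true) in S+v
  extends⇒ k S v () | true  | _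
  extends⇒ k S v () | false | false
  ... | false | true = refl , indepOfSize⇒ (suc k) (S [ v ]≔ true) S+v

  extends⇒indepOfSize : ∀ k S v → extends k S v ≡ true → indepOfSize k S ≡ true
  extends⇒indepOfSize k S v ext with v∉S , indep , size ← extends⇒ k S v ext = cong₂ _∧_
    (Independent⇒isIndependent G S (Independent-[]≔true⁻ G S v indep))
    (≡⇒hasSize k S (suc-injective (trans (sym (∣[]≔true∣ S v v∉S)) size)))

  extends⇒nonadjacent : ∀ k S {u} v → lookup S u ≡ true → extends k S v ≡ true →
                        not (lookup S v) ∧ not (adj G u v) ≡ true
  extends⇒nonadjacent k S v u∈S ext with v∉S , indep , _ ← extends⇒ k S v ext =
    cong₂ (λ x y → not x ∧ not y) v∉S (indep (lookup-[]≔true S v u∈S) (lookup∘update v S true))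

  nonneighbours-outside : ∀ S {u} → Independent G S → lookup S u ≡ true →
    ∑[ v < n ] 𝟙 (not (lookup S v) ∧ not (adj G u v)) ≡ n ∸ (∣ S ∣ + degree G u)
  nonneighbours-outside S {u} indep u∈S = begin
    X                                   ≡⟨ m+n∸m≡n (∣ S ∣ + degree G u) X ⟨
    ∣ S ∣ + degree G u + X ∸ (∣ S ∣ + degree G u)
      ≡⟨ cong (λ k → k ∸ (∣ S ∣ + degree G u)) partition ⟩
    n ∸ (∣ S ∣ + degree G u)            ∎
    where
    open ≡-Reasoning
    X = ∑[ v < n ] 𝟙 (not (lookup S v) ∧ not (adj G u v))
    disjoint : ∀ v → lookup S v ∧ adj G u v ≡ false
    disjoint v with lookup S v in v∈S
    ... | true  = indep u∈S v∈S
    ... | false = refl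
    partition : ∣ S ∣ + degree G u + X ≡ n
    partition rewrite ∣∣≡∑ S | degree≡∑ G u = ∑-𝟙-partition (lookup S) (adj G u) disjoint

  -- Every extension vertex lies outside S ∪ N(u) for a fixed u ∈ S, which exists as t ≥ 1.
  extensions≤ : ∀ {t δ} → 1 ≤ t → (∀ u → δ ≤ degree G u) → ∀ S →
    ∑[ v < n ] 𝟙 (extends t S v) ≤ 𝟙 (indepOfSize t S) * (n ∸ (t + δ))
  extensions≤ {t} {δ} t≥1 δ≤deg S with indepOfSize t S in S-indep
  ... | false = begin
    ∑[ v < n ] 𝟙 (extends t S v)
      ≤⟨ ∑-mono-≤ (λ v → 𝟙-mono (trans (sym S-indep) ∘ extends⇒indepOfSize t S v)) ⟩
    ∑[ v < n ] 0
      ≡⟨ sum-replicate-zero n ⟩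
    0 ∎
    where open ≤-Reasoning
  ... | true = begin
    ∑[ v < n ] 𝟙 (extends t S v)
      ≤⟨ ∑-mono-≤ (λ v → 𝟙-mono (extends⇒nonadjacent t S v u∈S)) ⟩
    ∑[ v < n ] 𝟙 (not (lookup S v) ∧ not (adj G u v))
      ≡⟨ nonneighbours-outside S indep u∈S ⟩
    n ∸ (∣ S ∣ + degree G u)
      ≤⟨ ∸-monoʳ-≤ n (+-mono-≤ (≤-reflexive (sym size)) (δ≤deg u)) ⟩
    n ∸ (t + δ)
      ≡⟨ +-identityʳ _ ⟨
    1 * (n ∸ (t + δ)) ∎
    where
    open ≤-Reasoning
    indep  = proj₁ (indepOfSize⇒ t S S-indep)
    size   = proj₂ (indepOfSize⇒ t S S-indep)
    member = ∃-member S (subst (1 ≤_) (sym size) t≥1)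
    u      = proj₁ member
    u∈S    = proj₂ member

  indepCount-suc-* : ∀ {t δ} → 1 ≤ t → (∀ u → δ ≤ degree G u) →
    indepCount (suc t) G * suc t ≤ indepCount t G * (n ∸ (t + δ))
  indepCount-suc-* {t} {δ} t≥1 δ≤deg = begin
    indepCount (suc t) G * suc t
      ≡⟨ cong (_* suc t) (countTrue-allSubsets (indepOfSize (suc t))) ⟩
    ∑ₛ (𝟙 ∘ indepOfSize (suc t)) * suc t
      ≡⟨ ∑ₛ-distribʳ-* (𝟙 ∘ indepOfSize (suc t)) (suc t) ⟨
    ∑ₛ (λ S → 𝟙 (indepOfSize (suc t) S) * suc t)
      ≡⟨ ∑ₛ-cong (𝟙-∧-hasSize-* (suc t) (isIndependent G)) ⟨
    ∑ₛ (λ S → 𝟙 (indepOfSize (suc t) S) * ∣ S ∣)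
      ≡⟨ ∑ₛ-size≡∑ₛ-extensions (indepOfSize (suc t)) ⟩
    ∑ₛ (λ S → ∑[ v < n ] 𝟙 (extends t S v))
      ≤⟨ ∑ₛ-mono-≤ (extensions≤ t≥1 δ≤deg) ⟩
    ∑ₛ (λ S → 𝟙 (indepOfSize t S) * (n ∸ (t + δ)))
      ≡⟨ ∑ₛ-distribʳ-* (𝟙 ∘ indepOfSize t) (n ∸ (t + δ)) ⟩
    ∑ₛ (𝟙 ∘ indepOfSize t) * (n ∸ (t + δ))
      ≡⟨ cong (_* (n ∸ (t + δ))) (countTrue-allSubsets (indepOfSize t)) ⟨
    indepCount t G * (n ∸ (t + δ)) ∎
    where open ≤-Reasoning

[k+1]*nC[k+1]+k*nCk≡n*nCk : ∀ n k → suc k * (n C suc k) + k * (n C k) ≡ n * (n C k)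
[k+1]*nC[k+1]+k*nCk≡n*nCk zero    zero    = refl
[k+1]*nC[k+1]+k*nCk≡n*nCk zero    (suc k) rewrite *-zeroʳ k = refl
[k+1]*nC[k+1]+k*nCk≡n*nCk (suc n) zero    =
  trans (+-identityʳ _) (trans (+-identityʳ _) (trans (nC1≡n (suc n)) (sym (*-identityʳ (suc n)))))
[k+1]*nC[k+1]+k*nCk≡n*nCk (suc n) (suc k)
  rewrite sym (nCk+nC[k+1]≡[n+1]C[k+1] n k) | sym (nCk+nC[k+1]≡[n+1]C[k+1] n (suc k)) = begin
  (2 + k) * (b + c) + (1 + k) * (a + b)
    ≡⟨ solve 4 (λ k a b c → (con 2 :+ k) :* (b :+ c) :+ (con 1 :+ k) :* (a :+ b) :=
                            ((con 2 :+ k) :* c :+ (con 1 :+ k) :* b) :+ ((con 1 :+ k) :* b :+ k :* a) :+ b :+ a)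
               refl k a b c ⟩
  ((2 + k) * c + (1 + k) * b) + ((1 + k) * b + k * a) + b + a
    ≡⟨ cong₂ (λ x y → x + y + b + a) ([k+1]*nC[k+1]+k*nCk≡n*nCk n (suc k)) ([k+1]*nC[k+1]+k*nCk≡n*nCk n k) ⟩
  n * b + n * a + b + a
    ≡⟨ solve 3 (λ n a b → n :* b :+ n :* a :+ b :+ a := (con 1 :+ n) :* (a :+ b)) refl n a b ⟩
  (1 + n) * (a + b) ∎
  where
  open ≡-Reasoning
  open +-*-Solver
  a = n C k
  b = n C suc k
  c = n C suc (suc k)

[k+1]*nC[k+1]≡[n∸k]*nCk : ∀ n k → suc k * (n C suc k) ≡ (n ∸ k) * (n C k)
[k+1]*nC[k+1]≡[n∸k]*nCk n k = begin
  suc k * (n C suc k)                               ≡⟨ m+n∸n≡m _ (k * (n C k)) ⟨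
  suc k * (n C suc k) + k * (n C k) ∸ k * (n C k)   ≡⟨ cong (_∸ k * (n C k)) ([k+1]*nC[k+1]+k*nCk≡n*nCk n k) ⟩
  n * (n C k) ∸ k * (n C k)                         ≡⟨ *-distribʳ-∸ (n C k) n k ⟨
  (n ∸ k) * (n C k)                                 ∎
  where open ≡-Reasoning

*-ratio-≤ : ∀ {a b x y r} s → b * suc s ≤ a * r → y * suc s ≡ x * r → a ≤ x → b ≤ y
*-ratio-≤ {a} {b} {x} {y} {r} s bs≤ar ys≡xr a≤x = *-cancelʳ-≤ b y (suc s) (begin
  b * suc s ≤⟨ bs≤ar ⟩
  a * r     ≤⟨ *-monoˡ-≤ r a≤x ⟩
  x * r     ≡⟨ ys≡xr ⟨
  y * suc s ∎)
  where open ≤-Reasoning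

*-ratio-< : ∀ {a b x y r} s → b * suc s ≤ a * r → y * suc s ≡ x * r → 0 < r → a < x → b < y
*-ratio-< {a} {b} {x} {y} {r} s bs≤ar ys≡xr r>0 a<x = *-cancelʳ-< (suc s) b y (begin-strict
  b * suc s ≤⟨ bs≤ar ⟩
  a * r     <⟨ *-monoˡ-< r {{>-nonZero r>0}} a<x ⟩
  x * r     ≡⟨ ys≡xr ⟨
  y * suc s ∎)
  where open ≤-Reasoning

lemma2p1 : (n δ t : ℕ) (G : Graph n) → 2 ≤ δ → suc δ ≤ t → MinDegree G δ →
    (indepCount t G ≤ (n ∸ δ) C t + δ C t →
       indepCount (suc t) G ≤ (n ∸ δ) C (suc t) + δ C (suc t))
    × (t < n ∸ δ → indepCount t G < (n ∸ δ) C t + δ C t →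
       indepCount (suc t) G < (n ∸ δ) C (suc t) + δ C (suc t))
lemma2p1 n δ t G _ δ<t (δ≤deg , _)
  rewrite k>n⇒nCk≡0 δ<t | k>n⇒nCk≡0 (m<n⇒m<1+n δ<t)
        | +-identityʳ ((n ∸ δ) C t) | +-identityʳ ((n ∸ δ) C suc t) = weak , strict
  where
  m = n ∸ δ
  counting : indepCount (suc t) G * suc t ≤ indepCount t G * (m ∸ t)
  counting = subst (λ d → indepCount (suc t) G * suc t ≤ indepCount t G * d)
    (trans (cong (n ∸_) (+-comm t δ)) (sym (∸-+-assoc n δ t)))
    (indepCount-suc-* G (≤-trans (s≤s z≤n) δ<t) δ≤deg)
  binomial : (m C suc t) * suc t ≡ (m C t) * (m ∸ t)
  binomial = trans (*-comm (m C suc t) (suc t))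
    (trans ([k+1]*nC[k+1]≡[n∸k]*nCk m t) (*-comm (m ∸ t) (m C t)))
  weak : indepCount t G ≤ m C t → indepCount (suc t) G ≤ m C suc t
  weak = *-ratio-≤ t counting binomial
  strict : t < m → indepCount t G < m C t → indepCount (suc t) G < m C suc t
  strict t<m = *-ratio-< t counting binomial (m<n⇒0<n∸m t<m)
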